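{- Let $\mathbf B$ be a Boolean-pointed Brouwerian algebra with constant $0$ and top element $1$. Let $B^{\bowtie}_0=\{\langle a,b\rangle\in B\times B: a\wedge b\le 0\}$ ordered by $\langle a,b\rangle\le\langle c,d\rangle$ iff $a\le c$ and $d\le b$, with multiplication $\langle a,b\rangle\circ\langle c,d\rangle=\langle a\wedge c,(a\to d)\wedge(c\to b)\rangle$. Let $\mu\langle a,b\rangle=\langle a,a\to b\rangle$ and $\nu\langle a,b\rangle=\langle b\to a,b\rangle$, and let $F=\{\langle a,b\rangle\in B^{\bowtie}_0: a\to b=b\text{ and }b\to a=a\}$ (the image of $\nu$ on the image of $\mu$). Equip $F$ with the inherited order, multiplication $m\circ_\nu n=\nu(m\circ n)$ with unit $\langle 1,0\rangle$, complement $\overline{\langle a,b\rangle}=\langle b,a\rangle$, and addition $m+n=\overline{\overline{n}\circ_\nu\overline{m}}$ with unit $\langle 0,1\rangle$. Then $F$ is a commutative bimonoid of fractions of $\mathbf B$ (viewed as a bimonoid with $x\cdot y=x\wedge y$, $x+y=(0\to(x\wedge y))\wedge(x\vee y)$, multiplicative unit $1$ and additive unit $0$) with the embedding $\iota_B(a)=\langle a,a\to 0\rangle$.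
   Context: A Brouwerian algebra is a distributive lattice with top $1$ and a binary operation $\to$ of relative pseudocomplement ($c\le a\to b\iff c\wedge a\le b$). It is Boolean-pointed if it has a constant $0$ such that the interval $[0,1]$ is a Boolean lattice. A commutative bimonoid is a poset with two commutative monoid operations $\cdot$ (unit $1$) and $+$ (unit $0$), both isotone, satisfying $x\cdot(y+z)\le(x\cdot y)+z$. An element $y$ is a complement of $x$ if $x\cdot y\le 0$ and $1\le x+y$; a complemented commutative bimonoid is one in which every element has a (necessarily unique) complement $\overline{x}$. A commutative bimonoid of fractions of a commutative bimonoid $\mathbf A$ is a complemented commutative bimonoid $\mathbf C$ with an embedding of bimonoids $\iota:\mathbf A\to\mathbf C$ (an order embedding preserving $\cdot,+,1,0$) such that every element of $\mathbf C$ has the form $\iota x+\overline{\iota y}$ for some $x,y\in A$ (equivalently, the form $\iota x\cdot\overline{\iota y}$). -}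

module Defs where

open import Level using (Level; _⊔_; suc)
open import Data.Product using (Σ; Σ-syntax; ∃; ∃-syntax; _×_; _,_; proj₁; proj₂)
open import Relation.Binary.Core using (Rel)
open import Relation.Binary.Structures using (IsPartialOrder)
open import Relation.Binary.Definitions using (Maximum)
open import Relation.Binary.Lattice.Definitions using (Exponential)
open import Relation.Binary.Lattice.Bundles using (DistributiveLattice)
open import Algebra.Core using (Op₁; Op₂)
open import Algebra.Structures using (IsCommutativeMonoid)

record BrouwerianAlgebra c ℓ₁ ℓ₂ : Set (suc (c ⊔ ℓ₁ ⊔ ℓ₂)) where
  field
    distributiveLattice : DistributiveLattice c ℓ₁ ℓ₂
  open DistributiveLattice distributiveLattice public
  field
    ⊤           : Carrier
    maximum     : Maximum _≤_ ⊤
    _⇨_         : Op₂ Carrier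
    exponential : Exponential _≤_ _∧_ _⇨_
  infixr 5 _⇨_

-- It is automatically a
-- distributive sublattice with bottom o and top ⊤, so being Boolean means
-- every element of the interval has a complement inside the interval.
IsBooleanInterval : ∀ {c ℓ₁ ℓ₂} (B : BrouwerianAlgebra c ℓ₁ ℓ₂) →
                    BrouwerianAlgebra.Carrier B → Set (c ⊔ ℓ₁ ⊔ ℓ₂)
IsBooleanInterval B o =
  ∀ x → o ≤ x → Σ[ y ∈ Carrier ] (o ≤ y × (x ∧ y) ≈ o × (x ∨ y) ≈ ⊤)
  where open BrouwerianAlgebra B

record BooleanPointedBrouwerianAlgebra c ℓ₁ ℓ₂ : Set (suc (c ⊔ ℓ₁ ⊔ ℓ₂)) where
  field
    brouwerianAlgebra : BrouwerianAlgebra c ℓ₁ ℓ₂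
  open BrouwerianAlgebra brouwerianAlgebra public
  field
    𝟘             : Carrier
    booleanInterval : IsBooleanInterval brouwerianAlgebra 𝟘

module _ {a ℓ₁ ℓ₂ : Level} {A : Set a} (_≈_ : Rel A ℓ₁) (_≤_ : Rel A ℓ₂) where

  record IsCommBimonoid (_·_ _+_ : Op₂ A) (1# 0# : A) : Set (a ⊔ ℓ₁ ⊔ ℓ₂) where
    field
      isPartialOrder        : IsPartialOrder _≈_ _≤_
      ·-isCommutativeMonoid : IsCommutativeMonoid _≈_ _·_ 1#
      +-isCommutativeMonoid : IsCommutativeMonoid _≈_ _+_ 0#
      ·-mono : ∀ {x x′ y y′} → x ≤ x′ → y ≤ y′ → (x · y) ≤ (x′ · y′)
      +-mono : ∀ {x x′ y y′} → x ≤ x′ → y ≤ y′ → (x + y) ≤ (x′ + y′)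
      linDistrib : ∀ x y z → (x · (y + z)) ≤ ((x · y) + z)

  IsComplement : (_·_ _+_ : Op₂ A) (1# 0# : A) → A → A → Set ℓ₂
  IsComplement _·_ _+_ 1# 0# x y = (x · y) ≤ 0# × 1# ≤ (x + y)

  record IsComplementedCommBimonoid (_·_ _+_ : Op₂ A) (1# 0# : A) (‾ : Op₁ A)
         : Set (a ⊔ ℓ₁ ⊔ ℓ₂) where
    field
      isCommBimonoid : IsCommBimonoid _·_ _+_ 1# 0#
      complement     : ∀ x → IsComplement _·_ _+_ 1# 0# x (‾ x)

record IsBimonoidEmbedding
  {a c ℓ₁ ℓ₂ ℓ₃ ℓ₄} {A : Set a} {C : Set c}
  (_≈A_ : Rel A ℓ₁) (_≤A_ : Rel A ℓ₂) (_·A_ _+A_ : Op₂ A) (1A 0A : A)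
  (_≈C_ : Rel C ℓ₃) (_≤C_ : Rel C ℓ₄) (_·C_ _+C_ : Op₂ C) (1C 0C : C)
  (ι : A → C) : Set (a ⊔ ℓ₂ ⊔ ℓ₃ ⊔ ℓ₄) where
  field
    order-reflecting : ∀ x y → ι x ≤C ι y → x ≤A y
    order-preserving : ∀ x y → x ≤A y → ι x ≤C ι y
    pres-·  : ∀ x y → ι (x ·A y) ≈C (ι x ·C ι y)
    pres-+  : ∀ x y → ι (x +A y) ≈C (ι x +C ι y)
    pres-1  : ι 1A ≈C 1C
    pres-0  : ι 0A ≈C 0C

record IsBimonoidOfFractions
  {a c ℓ₁ ℓ₂ ℓ₃ ℓ₄} {A : Set a} {C : Set c}
  (_≈A_ : Rel A ℓ₁) (_≤A_ : Rel A ℓ₂) (_·A_ _+A_ : Op₂ A) (1A 0A : A)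
  (_≈C_ : Rel C ℓ₃) (_≤C_ : Rel C ℓ₄) (_·C_ _+C_ : Op₂ C) (1C 0C : C) (‾ : Op₁ C)
  (ι : A → C) : Set (a ⊔ c ⊔ ℓ₂ ⊔ ℓ₃ ⊔ ℓ₄) where
  field
    isComplemented : IsComplementedCommBimonoid _≈C_ _≤C_ _·C_ _+C_ 1C 0C ‾
    isEmbedding    : IsBimonoidEmbedding _≈A_ _≤A_ _·A_ _+A_ 1A 0A
                                         _≈C_ _≤C_ _·C_ _+C_ 1C 0C ι
    fractions      : ∀ z → ∃[ x ] ∃[ y ] (z ≈C (ι x +C ‾ (ι y)))

module Construction {c ℓ₁ ℓ₂} (𝐁 : BooleanPointedBrouwerianAlgebra c ℓ₁ ℓ₂) where
  open BooleanPointedBrouwerianAlgebra 𝐁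

  _·B_ : Op₂ Carrier
  x ·B y = x ∧ y

  _+B_ : Op₂ Carrier
  x +B y = (𝟘 ⇨ (x ∧ y)) ∧ (x ∨ y)

  P : Set c
  P = Carrier × Carrier

  _≈P_ : Rel P ℓ₁
  (a , b) ≈P (c′ , d) = a ≈ c′ × b ≈ d

  _≤P_ : Rel P ℓ₂
  (a , b) ≤P (c′ , d) = a ≤ c′ × d ≤ b

  InB0 : P → Set ℓ₂
  InB0 (a , b) = (a ∧ b) ≤ 𝟘

  _∘_ : Op₂ P
  (a , b) ∘ (c′ , d) = (a ∧ c′ , (a ⇨ d) ∧ (c′ ⇨ b))

  μ : P → P
  μ (a , b) = (a , a ⇨ b)

  ν : P → P
  ν (a , b) = (b ⇨ a , b)

  bar : P → P
  bar (a , b) = (b , a)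

  InF : P → Set (ℓ₁ ⊔ ℓ₂)
  InF (a , b) = InB0 (a , b) × (a ⇨ b) ≈ b × (b ⇨ a) ≈ a

  F : Set (c ⊔ ℓ₁ ⊔ ℓ₂)
  F = Σ P InF

  -- well-definedness of the operations on F (part of the claim)
  record FClosure : Set (c ⊔ ℓ₁ ⊔ ℓ₂) where
    field
      ∘ν-closed  : ∀ m n → InF m → InF n → InF (ν (m ∘ n))
      bar-closed : ∀ m → InF m → InF (bar m)
      one-in     : InF (⊤ , 𝟘)
      zero-in    : InF (𝟘 , ⊤)
      ι-in       : ∀ a → InF (a , a ⇨ 𝟘)

  _≈F_ : Rel F ℓ₁
  m ≈F n = proj₁ m ≈P proj₁ n

  _≤F_ : Rel F ℓ₂
  m ≤F n = proj₁ m ≤P proj₁ n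

  module Ops (cl : FClosure) where
    open FClosure cl

    _∘ν_ : Op₂ F
    (m , pm) ∘ν (n , pn) = ν (m ∘ n) , ∘ν-closed m n pm pn

    barF : Op₁ F
    barF (m , pm) = bar m , bar-closed m pm

    _+F_ : Op₂ F
    m +F n = barF (barF n ∘ν barF m)

    1F : F
    1F = (⊤ , 𝟘) , one-in

    0F : F
    0F = (𝟘 , ⊤) , zero-in

    ιB : Carrier → F
    ιB a = (a , a ⇨ 𝟘) , ι-in a

{-# OPTIONS --safe #-}
module Submission where

-- All laws are inequalities between ⇨-terms, proved as derivations in the
-- internal intuitionistic logic of the Brouwerian algebra.  Apart from those
-- about the embedding ι they hold for an arbitrary point 𝟘; the embedding
-- needs the relative excluded middle  ⊤ ≤ a ∨ 𝟘 ∨ (a ⇨ 𝟘)  supplied by the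
-- Boolean interval [𝟘, ⊤], e.g. ι a ∈ F amounts to  (a ⇨ 𝟘) ⇨ a ≤ a.
-- Complementation ⟨a , b⟩ ↦ ⟨b , a⟩ is an order-reversing involution turning
-- ∘ν into +, so the laws of + are those of ∘ν read upside down.

open import Defs
open import Level using (Level)
open import Data.Product using (Σ-syntax; _×_; _,_; proj₁; proj₂; ∃-syntax)
open import Relation.Binary.Core using (Rel)
open import Relation.Binary.Structures using (IsPartialOrder)
open import Algebra.Core using (Op₂)
open import Algebra.Structures using (IsCommutativeMonoid)
import Relation.Binary.Lattice.Properties.MeetSemilattice as MeetSemilatticeProperties
import Relation.Binary.Lattice.Properties.JoinSemilattice as JoinSemilatticeProperties

module _ {a ℓ₁ ℓ₂} {A : Set a} {_≈_ : Rel A ℓ₁} {_≤_ : Rel A ℓ₂}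
         (isPartialOrder : IsPartialOrder _≈_ _≤_) where
  open IsPartialOrder isPartialOrder

  isCommutativeMonoid-≤ : (_·_ : Op₂ A) (e : A) →
    (∀ {x x′ y y′} → x ≤ x′ → y ≤ y′ → (x · y) ≤ (x′ · y′)) →
    (∀ x y z → ((x · y) · z) ≤ (x · (y · z))) →
    (∀ x y → (x · y) ≤ (y · x)) →
    (∀ x → (x · e) ≈ x) →
    IsCommutativeMonoid _≈_ _·_ e
  isCommutativeMonoid-≤ _·_ e mono assoc≤ comm≤ identityʳ = record
    { isMonoid = record
      { isSemigroup = record
        { isMagma = record
          { isEquivalence = isEquivalence
          ; ∙-cong = λ p q → antisym (mono (reflexive p) (reflexive q))
                                     (mono (reflexive (Eq.sym p)) (reflexive (Eq.sym q)))
          }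
        ; assoc = λ x y z → antisym (assoc≤ x y z) (assoc≥ x y z)
        }
      ; identity = (λ x → Eq.trans (comm e x) (identityʳ x)) , identityʳ
      }
    ; comm = comm
    }
    where
    comm : ∀ x y → (x · y) ≈ (y · x)
    comm x y = antisym (comm≤ x y) (comm≤ y x)

    assoc≥ : ∀ x y z → (x · (y · z)) ≤ ((x · y) · z)
    assoc≥ x y z =
      trans (comm≤ x (y · z)) (trans (mono (comm≤ y z) refl) (trans (assoc≤ z y x)
        (trans (comm≤ z (y · x)) (mono (comm≤ y x) refl))))

-- An inequality  w ≤ x  is read as a derivation of x from the context w.
-- Contexts are extended on the right (w ∧ a ∧ b …), lam / mp are
-- ⇨-introduction / elimination, and v₀, v₁, … are de Bruijn variables
-- picking the last, second-to-last, … hypothesis.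
module BrouwerianReasoning {c ℓ₁ ℓ₂} (B : BrouwerianAlgebra c ℓ₁ ℓ₂) where
  open BrouwerianAlgebra B
  open MeetSemilatticeProperties meetSemilattice public using (∧-monotonic)
  open JoinSemilatticeProperties joinSemilattice public using (∨-monotonic)

  infixr 5 _⟫_
  _⟫_ : ∀ {x y z} → x ≤ y → y ≤ z → x ≤ z
  _⟫_ = trans

  ≤⊤ : ∀ {w} → w ≤ ⊤
  ≤⊤ {w} = maximum w

  π₁ : ∀ {x y} → x ∧ y ≤ x
  π₁ {x} {y} = x∧y≤x x y

  π₂ : ∀ {x y} → x ∧ y ≤ y
  π₂ {x} {y} = x∧y≤y x y

  ⟨_,_⟩ : ∀ {w x y} → w ≤ x → w ≤ y → w ≤ x ∧ y
  ⟨_,_⟩ = ∧-greatest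

  fst : ∀ {w x y} → w ≤ x ∧ y → w ≤ x
  fst p = p ⟫ π₁

  snd : ∀ {w x y} → w ≤ x ∧ y → w ≤ y
  snd p = p ⟫ π₂

  inl : ∀ {w x y} → w ≤ x → w ≤ x ∨ y
  inl {x = x} {y} p = p ⟫ x≤x∨y x y

  inr : ∀ {w x y} → w ≤ y → w ≤ x ∨ y
  inr {x = x} {y} p = p ⟫ y≤x∨y x y

  case : ∀ {w x y z} → w ≤ x ∨ y → w ∧ x ≤ z → w ∧ y ≤ z → w ≤ z
  case {w} {x} {y} p q r = ⟨ refl , p ⟩ ⟫ reflexive (∧-distribˡ-∨ w x y) ⟫ ∨-least q r

  lam : ∀ {w x y} → w ∧ x ≤ y → w ≤ x ⇨ y
  lam {w} {x} {y} = proj₁ (exponential w x y)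

  app : ∀ {w x y} → w ≤ x ⇨ y → w ∧ x ≤ y
  app {w} {x} {y} = proj₂ (exponential w x y)

  mp : ∀ {w x y} → w ≤ x ⇨ y → w ≤ x → w ≤ y
  mp p q = ⟨ p , q ⟩ ⟫ app refl

  wk : ∀ {w x y} → w ≤ y → w ∧ x ≤ y
  wk p = π₁ ⟫ p

  v₀ : ∀ {w x} → w ∧ x ≤ x
  v₀ = π₂

  v₁ : ∀ {w x y} → (w ∧ x) ∧ y ≤ x
  v₁ = wk v₀

  ∧-swap : ∀ {x y} → x ∧ y ≤ y ∧ x
  ∧-swap = ⟨ π₂ , π₁ ⟩

  ∨-swap : ∀ {x y} → x ∨ y ≤ y ∨ x
  ∨-swap = ∨-least (inr refl) (inl refl)

  ⇨-relax : ∀ {x x′ y y′} → x′ ≤ x → y ≤ y′ → x ⇨ y ≤ x′ ⇨ y′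
  ⇨-relax p q = lam (mp π₁ (π₂ ⟫ p) ⟫ q)

  discharge : ∀ {w a b} → (a ⇨ b) ≈ b → w ∧ a ≤ b → w ≤ b
  discharge e p = lam p ⟫ reflexive e

module PointedBimonoid {c ℓ₁ ℓ₂} (B : BrouwerianAlgebra c ℓ₁ ℓ₂)
                       (o : BrouwerianAlgebra.Carrier B) where
  open BrouwerianAlgebra B
  open BrouwerianReasoning B

  infixr 6 _⊕_
  _⊕_ : Op₂ Carrier
  x ⊕ y = (o ⇨ (x ∧ y)) ∧ (x ∨ y)

  ⊕-mono : ∀ {x x′ y y′} → x ≤ x′ → y ≤ y′ → x ⊕ y ≤ x′ ⊕ y′
  ⊕-mono p q = ∧-monotonic (⇨-relax refl (∧-monotonic p q)) (∨-monotonic p q)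

  ⊕-comm≤ : ∀ x y → x ⊕ y ≤ y ⊕ x
  ⊕-comm≤ x y = ∧-monotonic (⇨-relax refl ∧-swap) ∨-swap

  ⊕-assoc≤ : ∀ x y z → (x ⊕ y) ⊕ z ≤ x ⊕ (y ⊕ z)
  ⊕-assoc≤ x y z =
    ⟨ lam ⟨ fst xy , ⟨ lam ⟨ wk (snd xy) , wk (snd [x⊕y]z) ⟩ , inl (snd xy) ⟩ ⟩
    , case π₂ (case (π₂ ⟫ π₂) (inl v₀) (inr ⟨ lam ⟨ v₁ , z′ ⟩ , inl v₀ ⟩))
              (inr ⟨ lam ⟨ y′ , v₁ ⟩ , inr v₀ ⟩)
    ⟩
    where
    W : Carrier
    W = (x ⊕ y) ⊕ z
    [x⊕y]z : W ∧ o ≤ (x ⊕ y) ∧ z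
    [x⊕y]z = mp (π₁ ⟫ π₁) v₀
    xy : W ∧ o ≤ x ∧ y
    xy = mp (fst (fst [x⊕y]z)) v₀
    z′ : ((W ∧ (x ⊕ y)) ∧ y) ∧ o ≤ z
    z′ = snd (mp (π₁ ⟫ π₁ ⟫ π₁ ⟫ π₁) v₀)
    y′ : (W ∧ z) ∧ o ≤ y
    y′ = snd (mp (fst (fst (mp (π₁ ⟫ π₁ ⟫ π₁) v₀))) v₀)

  ⊕-identityʳ : ∀ x → x ⊕ o ≈ x
  ⊕-identityʳ x = antisym (case π₂ v₀ (fst (mp (π₁ ⟫ π₁) v₀))) ⟨ lam refl , inl refl ⟩

  ∧-⊕-linDistrib : ∀ x y z → x ∧ (y ⊕ z) ≤ (x ∧ y) ⊕ z
  ∧-⊕-linDistrib x y z =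
    ⟨ lam ⟨ ⟨ π₁ ⟫ π₁ , fst yz ⟩ , snd yz ⟩ , case (snd π₂) (inl ⟨ π₁ ⟫ π₁ , v₀ ⟩) (inr v₀) ⟩
    where
    yz : (x ∧ (y ⊕ z)) ∧ o ≤ y ∧ z
    yz = mp (π₁ ⟫ π₂ ⟫ π₁) v₀

  isCommBimonoid : IsCommBimonoid _≈_ _≤_ _∧_ _⊕_ ⊤ o
  isCommBimonoid = record
    { isPartialOrder = isPartialOrder
    ; ·-isCommutativeMonoid = isCommutativeMonoid-≤ isPartialOrder _∧_ ⊤ ∧-monotonic
        (λ x y z → ⟨ π₁ ⟫ π₁ , ∧-monotonic π₂ refl ⟩) (λ x y → ∧-swap)
        (λ x → antisym π₁ ⟨ refl , ≤⊤ ⟩)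
    ; +-isCommutativeMonoid =
        isCommutativeMonoid-≤ isPartialOrder _⊕_ o ⊕-mono ⊕-assoc≤ ⊕-comm≤ ⊕-identityʳ
    ; ·-mono = ∧-monotonic
    ; +-mono = ⊕-mono
    ; linDistrib = ∧-⊕-linDistrib
    }

module Fractions {c ℓ₁ ℓ₂} (𝐁 : BooleanPointedBrouwerianAlgebra c ℓ₁ ℓ₂) where
  open BooleanPointedBrouwerianAlgebra 𝐁
  open Construction 𝐁
  open BrouwerianReasoning brouwerianAlgebra

  excludedMiddle : ∀ a → ⊤ ≤ (a ∨ 𝟘) ∨ (a ⇨ 𝟘)
  excludedMiddle a with booleanInterval (a ∨ 𝟘) (inr refl)
  ... | _ , _ , meet , join =
    reflexive (Eq.sym join)
    ⟫ ∨-monotonic refl (lam (∧-monotonic refl (inl refl) ⟫ ∧-swap ⟫ reflexive meet))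

  consequentiaMirabilis : ∀ a → (a ⇨ 𝟘) ⇨ a ≤ a
  consequentiaMirabilis a =
    case (≤⊤ ⟫ excludedMiddle a) (case v₀ v₀ (mp (π₁ ⟫ π₁) (lam v₁))) (mp π₁ v₀)

  -- ⟨a , b⟩ ∘ν ⟨c , d⟩ = ⟨A , D⟩ with D = (a ⇨ d) ∧ (c ⇨ b) and A = D ⇨ (a ∧ c);
  -- below, A-names and D-names (AL, DR, …) are first and second components of
  -- such products.
  InF-∘ν : ∀ m n → InF m → InF n → InF (ν (m ∘ n))
  InF-∘ν (a , b) (c , d) (ab≤𝟘 , a⇨b≈b , _) (_ , c⇨d≈d , _) = A∧D≤𝟘 , A⇨D≈D , D⇨A≈A
    where
    D A : Carrier
    D = (a ⇨ d) ∧ (c ⇨ b)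
    A = D ⇨ (a ∧ c)
    A∧D≤𝟘 : A ∧ D ≤ 𝟘
    A∧D≤𝟘 = ⟨ fst (mp π₁ π₂) , mp (snd π₂) (snd (mp π₁ π₂)) ⟩ ⟫ ab≤𝟘
    A⇨D≈D : (A ⇨ D) ≈ D
    A⇨D≈D = antisym ⟨ lam (discharge c⇨d≈d (mp (fst (D-from (π₁ ⟫ π₁) v₁ v₀)) v₁))
                    , lam (discharge a⇨b≈b (mp (snd (D-from (π₁ ⟫ π₁) v₀ v₁)) v₁)) ⟩
                    (lam π₁)
      where
      D-from : ∀ {w} → w ≤ A ⇨ D → w ≤ a → w ≤ c → w ≤ D
      D-from x ha hc = mp x (lam ⟨ wk ha , wk hc ⟩)
    D⇨A≈A : (D ⇨ A) ≈ A
    D⇨A≈A = antisym (lam (mp (mp π₁ π₂) π₂)) (lam π₁)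

  InF-bar : ∀ m → InF m → InF (bar m)
  InF-bar (a , b) (ab≤𝟘 , a⇨b≈b , b⇨a≈a) = ∧-swap ⟫ ab≤𝟘 , b⇨a≈a , a⇨b≈b

  InF-⊤𝟘 : InF (⊤ , 𝟘)
  InF-⊤𝟘 = π₂ , antisym (mp refl ≤⊤) (lam π₁) , antisym ≤⊤ (lam π₁)

  InF-ι : ∀ a → InF (a , a ⇨ 𝟘)
  InF-ι a = ∧-swap ⟫ app refl
          , antisym (lam (mp (mp π₁ π₂) π₂)) (lam π₁)
          , antisym (consequentiaMirabilis a) (lam π₁)

  fClosure : FClosure
  fClosure = record
    { ∘ν-closed  = InF-∘ν
    ; bar-closed = InF-bar
    ; one-in     = InF-⊤𝟘
    ; zero-in    = InF-bar (⊤ , 𝟘) InF-⊤𝟘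
    ; ι-in       = InF-ι
    }

  open Ops fClosure

  ≤F-isPartialOrder : IsPartialOrder _≈F_ _≤F_
  ≤F-isPartialOrder = record
    { isPreorder = record
      { isEquivalence = record
        { refl  = Eq.refl , Eq.refl
        ; sym   = λ (p , q) → Eq.sym p , Eq.sym q
        ; trans = λ (p , q) (p′ , q′) → Eq.trans p p′ , Eq.trans q q′
        }
      ; reflexive = λ (p , q) → reflexive p , reflexive (Eq.sym q)
      ; trans     = λ (p , q) (p′ , q′) → p ⟫ p′ , q′ ⟫ q
      }
    ; antisym = λ (p , q) (p′ , q′) → antisym p p′ , antisym q′ q
    }

  ∘ν-mono : ∀ {x x′ y y′} → x ≤F x′ → y ≤F y′ → (x ∘ν y) ≤F (x′ ∘ν y′)
  ∘ν-mono {(a , b) , _} {(a′ , b′) , _} {(c , d) , _} {(c′ , d′) , _} (a≤a′ , b′≤b) (c≤c′ , d′≤d) =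
    ⇨-relax D′≤D (∧-monotonic a≤a′ c≤c′) , D′≤D
    where
    D′≤D : (a′ ⇨ d′) ∧ (c′ ⇨ b′) ≤ (a ⇨ d) ∧ (c ⇨ b)
    D′≤D = ∧-monotonic (⇨-relax a≤a′ d′≤d) (⇨-relax c≤c′ b′≤b)

  ∘ν-comm≤ : ∀ x y → (x ∘ν y) ≤F (y ∘ν x)
  ∘ν-comm≤ x y = ⇨-relax ∧-swap ∧-swap , ∧-swap

  ∘ν-identityʳ : ∀ x → (x ∘ν 1F) ≈F x
  ∘ν-identityʳ ((a , b) , (ab≤𝟘 , _ , b⇨a≈a)) =
      antisym (discharge b⇨a≈a (fst (mp π₁ (π₂ ⟫ b≤D)))) (lam ⟨ π₁ , ≤⊤ ⟩)
    , antisym (mp (snd refl) ≤⊤) b≤D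
    where
    b≤D : b ≤ (a ⇨ 𝟘) ∧ (⊤ ⇨ b)
    b≤D = ⟨ lam (∧-swap ⟫ ab≤𝟘) , lam π₁ ⟩

  ∘ν-assoc≤ : ∀ x y z → ((x ∘ν y) ∘ν z) ≤F (x ∘ν (y ∘ν z))
  ∘ν-assoc≤ ((a , b) , _) ((c , d) , _) ((e , f) , (_ , e⇨f≈f , _)) = AL≤AR , DR≤DL
    where
    D A DL AL D′ A′ DR : Carrier
    D = (a ⇨ d) ∧ (c ⇨ b)
    A = D ⇨ (a ∧ c)
    DL = (A ⇨ f) ∧ (e ⇨ D)
    AL = DL ⇨ (A ∧ e)
    D′ = (c ⇨ f) ∧ (e ⇨ d)
    A′ = D′ ⇨ (c ∧ e)
    DR = (a ⇨ D′) ∧ (A′ ⇨ b)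
    D-from : ∀ {w} → w ≤ DR → w ≤ e → w ≤ D
    D-from h he = ⟨ lam (mp (snd (mp (wk (fst h)) v₀)) (wk he))
                  , lam (mp (wk (snd h)) (lam ⟨ v₁ , wk (wk he) ⟩)) ⟩
    DR≤DL : DR ≤ DL
    DR≤DL = ⟨ lam (discharge e⇨f≈f f′) , lam (D-from π₁ π₂) ⟩
      where
      ac : (DR ∧ A) ∧ e ≤ a ∧ c
      ac = mp v₁ (D-from (π₁ ⟫ π₁) v₀)
      f′ : (DR ∧ A) ∧ e ≤ f
      f′ = mp (fst (mp (fst (π₁ ⟫ π₁)) (fst ac))) (snd ac)
    AL≤AR : AL ≤ DR ⇨ (a ∧ A′)
    AL≤AR = lam ⟨ fst ac , lam ⟨ wk (snd ac) , wk (snd Ae) ⟩ ⟩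
      where
      Ae : AL ∧ DR ≤ A ∧ e
      Ae = mp π₁ (π₂ ⟫ DR≤DL)
      ac : AL ∧ DR ≤ a ∧ c
      ac = mp (fst Ae) (D-from π₂ (snd Ae))

  ∘ν-+F-linDistrib : ∀ x y z → (x ∘ν (y +F z)) ≤F ((x ∘ν y) +F z)
  ∘ν-+F-linDistrib ((a , b) , (_ , a⇨b≈b , _)) ((c , d) , _) ((e , f) , (_ , _ , f⇨e≈e)) =
    AL≤G′ , X≤DL
    where
    G H DL AL D A G′ X : Carrier
    G = (f ⇨ c) ∧ (d ⇨ e)
    H = G ⇨ (f ∧ d)
    DL = (a ⇨ H) ∧ (G ⇨ b)
    AL = DL ⇨ (a ∧ G)
    D = (a ⇨ d) ∧ (c ⇨ b)
    A = D ⇨ (a ∧ c)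
    G′ = (f ⇨ A) ∧ (D ⇨ e)
    X = G′ ⇨ (f ∧ D)
    DL-from : ∀ {w} → w ≤ D → w ≤ f → w ≤ DL
    DL-from hD hf = ⟨ lam (lam ⟨ wk (wk hf) , mp (wk (wk (fst hD))) v₁ ⟩)
                    , lam (mp (wk (snd hD)) (mp (fst v₀) (wk hf))) ⟩
    G′-from : ∀ {w} → w ≤ a → w ≤ G → w ≤ G′
    G′-from ha hG = ⟨ lam (lam ⟨ wk (wk ha) , mp (fst (wk (wk hG))) v₁ ⟩)
                    , lam (mp (snd (wk hG)) (mp (fst v₀) (wk ha))) ⟩
    AL≤G′ : AL ≤ G′
    AL≤G′ = ⟨ lam (lam ac) , lam (discharge f⇨e≈e e′) ⟩
      where
      aG : (AL ∧ f) ∧ D ≤ a ∧ G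
      aG = mp (π₁ ⟫ π₁) (DL-from v₀ v₁)
      ac : (AL ∧ f) ∧ D ≤ a ∧ c
      ac = ⟨ fst aG , mp (fst (snd aG)) v₁ ⟩
      aG′ : (AL ∧ D) ∧ f ≤ a ∧ G
      aG′ = mp (π₁ ⟫ π₁) (DL-from v₁ v₀)
      e′ : (AL ∧ D) ∧ f ≤ e
      e′ = mp (snd (snd aG′)) (mp (fst v₁) (fst aG′))
    X≤DL : X ≤ DL
    X≤DL = ⟨ lam (lam fd) , lam (discharge a⇨b≈b b′) ⟩
      where
      fD : (X ∧ a) ∧ G ≤ f ∧ D
      fD = mp (π₁ ⟫ π₁) (G′-from v₁ v₀)
      fd : (X ∧ a) ∧ G ≤ f ∧ d
      fd = ⟨ fst fD , mp (fst (snd fD)) v₁ ⟩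
      fD′ : (X ∧ G) ∧ a ≤ f ∧ D
      fD′ = mp (π₁ ⟫ π₁) (G′-from v₀ v₁)
      b′ : (X ∧ G) ∧ a ≤ b
      b′ = mp (snd (snd fD′)) (mp (fst v₁) (fst fD′))

  ∘ν-isCommutativeMonoid : IsCommutativeMonoid _≈F_ _∘ν_ 1F
  ∘ν-isCommutativeMonoid =
    isCommutativeMonoid-≤ ≤F-isPartialOrder _∘ν_ 1F (λ {x x′ y y′} → ∘ν-mono {x} {x′} {y} {y′})
      ∘ν-assoc≤ ∘ν-comm≤ ∘ν-identityʳ

  -- _≤F_ and _≈F_ ignore the membership proofs, so arguments of F-lemmas
  -- can rarely be inferred and are passed explicitly.
  barF-antitone : ∀ x y → x ≤F y → barF y ≤F barF x
  barF-antitone _ _ (p , q) = q , p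

  barF-cong : ∀ x y → x ≈F y → barF x ≈F barF y
  barF-cong _ _ (p , q) = q , p

  +F-mono : ∀ {x x′ y y′} → x ≤F x′ → y ≤F y′ → (x +F y) ≤F (x′ +F y′)
  +F-mono {x} {x′} {y} {y′} p q =
    barF-antitone (barF y′ ∘ν barF x′) (barF y ∘ν barF x)
      (∘ν-mono {barF y′} {barF y} {barF x′} {barF x} (barF-antitone y y′ q) (barF-antitone x x′ p))

  +F-comm≤ : ∀ x y → (x +F y) ≤F (y +F x)
  +F-comm≤ x y =
    barF-antitone (barF x ∘ν barF y) (barF y ∘ν barF x) (∘ν-comm≤ (barF x) (barF y))

  +F-assoc≤ : ∀ x y z → ((x +F y) +F z) ≤F (x +F (y +F z))
  +F-assoc≤ x y z =
    barF-antitone ((barF z ∘ν barF y) ∘ν barF x) (barF z ∘ν (barF y ∘ν barF x))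
                  (∘ν-assoc≤ (barF z) (barF y) (barF x))

  +F-identityʳ : ∀ x → (x +F 0F) ≈F x
  +F-identityʳ x = barF-cong (1F ∘ν barF x) (barF x) (∘ν-identityˡ (barF x))
    where open IsCommutativeMonoid ∘ν-isCommutativeMonoid renaming (identityˡ to ∘ν-identityˡ)

  ∘ν-+F-isCommBimonoid : IsCommBimonoid _≈F_ _≤F_ _∘ν_ _+F_ 1F 0F
  ∘ν-+F-isCommBimonoid = record
    { isPartialOrder        = ≤F-isPartialOrder
    ; ·-isCommutativeMonoid = ∘ν-isCommutativeMonoid
    ; +-isCommutativeMonoid =
        isCommutativeMonoid-≤ ≤F-isPartialOrder _+F_ 0F (λ {x x′ y y′} → +F-mono {x} {x′} {y} {y′})
          +F-assoc≤ +F-comm≤ +F-identityʳ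
    ; ·-mono     = λ {x x′ y y′} → ∘ν-mono {x} {x′} {y} {y′}
    ; +-mono     = λ {x x′ y y′} → +F-mono {x} {x′} {y} {y′}
    ; linDistrib = ∘ν-+F-linDistrib
    }

  barF-isComplement : ∀ x → IsComplement _≈F_ _≤F_ _∘ν_ _+F_ 1F 0F x (barF x)
  barF-isComplement ((a , b) , (ab≤𝟘 , _ , _)) =
    (mp refl ⊤≤D ⟫ ab≤𝟘 , ⊤≤D) , (⊤≤D , mp refl ⊤≤D ⟫ ab≤𝟘)
    where
    ⊤≤D : ∀ {w} → w ≤ (a ⇨ a) ∧ (b ⇨ b)
    ⊤≤D = ⟨ lam v₀ , lam v₀ ⟩

  ιB-∧ : ∀ x y → ιB (x ∧ y) ≈F (ιB x ∘ν ιB y)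
  ιB-∧ x y = antisym (lam π₁) (⇨-relax ¬[x∧y]≤D refl ⟫ consequentiaMirabilis (x ∧ y))
           , antisym ¬[x∧y]≤D D≤¬[x∧y]
    where
    D : Carrier
    D = (x ⇨ (y ⇨ 𝟘)) ∧ (y ⇨ (x ⇨ 𝟘))
    ¬[x∧y]≤D : (x ∧ y) ⇨ 𝟘 ≤ D
    ¬[x∧y]≤D = ⟨ lam (lam (mp (π₁ ⟫ π₁) ⟨ v₁ , v₀ ⟩))
               , lam (lam (mp (π₁ ⟫ π₁) ⟨ v₀ , v₁ ⟩)) ⟩
    D≤¬[x∧y] : D ≤ (x ∧ y) ⇨ 𝟘
    D≤¬[x∧y] = lam (mp (mp (fst π₁) (fst π₂)) (snd π₂))

  ιB-+ : ∀ x y → ιB (x +B y) ≈F (ιB x +F ιB y)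
  ιB-+ x y = antisym S≤G G≤S , antisym ¬S≤G⇨ G⇨≤¬S
    where
    S G : Carrier
    S = x +B y
    G = ((y ⇨ 𝟘) ⇨ x) ∧ ((x ⇨ 𝟘) ⇨ y)
    S≤G : S ≤ G
    S≤G = ⟨ lam (case (snd π₁) v₀ (fst (mp (fst (π₁ ⟫ π₁)) (mp v₁ v₀))))
          , lam (case (snd π₁) (snd (mp (fst (π₁ ⟫ π₁)) (mp v₁ v₀))) v₀) ⟩
    G≤S : G ≤ S
    G≤S = ⟨ lam ⟨ mp (fst π₁) (lam v₁) , mp (snd π₁) (lam v₁) ⟩
          , case (≤⊤ ⟫ excludedMiddle x) (case v₀ (inl v₀) (inl (mp (fst (π₁ ⟫ π₁)) (lam v₁))))
                                         (inr (mp (snd π₁) v₀)) ⟩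
    ¬S≤G⇨ : S ⇨ 𝟘 ≤ G ⇨ ((y ⇨ 𝟘) ∧ (x ⇨ 𝟘))
    ¬S≤G⇨ = lam ⟨ lam (mp (π₁ ⟫ π₁) (wk (v₀ ⟫ G≤S)))
                , lam (mp (π₁ ⟫ π₁) (wk (v₀ ⟫ G≤S))) ⟩
    G⇨≤¬S : G ⇨ ((y ⇨ 𝟘) ∧ (x ⇨ 𝟘)) ≤ S ⇨ 𝟘
    G⇨≤¬S = lam (case (snd v₀) (mp (snd (wk ¬y¬x)) v₀) (mp (fst (wk ¬y¬x)) v₀))
      where
      ¬y¬x : (G ⇨ ((y ⇨ 𝟘) ∧ (x ⇨ 𝟘))) ∧ S ≤ (y ⇨ 𝟘) ∧ (x ⇨ 𝟘)
      ¬y¬x = mp π₁ (v₀ ⟫ S≤G)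

  ιB-isBimonoidEmbedding : IsBimonoidEmbedding _≈_ _≤_ _·B_ _+B_ ⊤ 𝟘 _≈F_ _≤F_ _∘ν_ _+F_ 1F 0F ιB
  ιB-isBimonoidEmbedding = record
    { order-reflecting = λ _ _ → proj₁
    ; order-preserving = λ _ _ p → p , ⇨-relax p refl
    ; pres-· = ιB-∧
    ; pres-+ = ιB-+
    ; pres-1 = Eq.refl , antisym (mp refl ≤⊤) (lam π₁)
    ; pres-0 = Eq.refl , antisym ≤⊤ (lam π₂)
    }

  fraction : ∀ z → ∃[ x ] ∃[ y ] (z ≈F (ιB x +F barF (ιB y)))
  fraction ((a , b) , (ab≤𝟘 , a⇨b≈b , b⇨a≈a)) =
    a , b , antisym a≤S (fst refl ⟫ reflexive b⇨a≈a)
          , antisym b≤S⇨ (discharge a⇨b≈b (fst (mp π₁ (π₂ ⟫ a≤S))))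
    where
    S : Carrier
    S = (b ⇨ a) ∧ ((a ⇨ 𝟘) ⇨ (b ⇨ 𝟘))
    a≤S : a ≤ S
    a≤S = ⟨ lam π₁ , lam (lam (mp v₁ (π₁ ⟫ π₁))) ⟩
    b≤S⇨ : b ≤ S ⇨ (b ∧ (a ⇨ 𝟘))
    b≤S⇨ = lam ⟨ π₁ , lam (⟨ v₀ , π₁ ⟫ π₁ ⟩ ⟫ ab≤𝟘) ⟩

mainTheorem4 : ∀ {c ℓ₁ ℓ₂ : Level} (𝐁 : BooleanPointedBrouwerianAlgebra c ℓ₁ ℓ₂) →
    let open BooleanPointedBrouwerianAlgebra 𝐁
        open Construction 𝐁
    in IsCommBimonoid _≈_ _≤_ _·B_ _+B_ ⊤ 𝟘
       × (Σ[ cl ∈ FClosure ]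
           IsBimonoidOfFractions _≈_ _≤_ _·B_ _+B_ ⊤ 𝟘
             _≈F_ _≤F_ (Ops._∘ν_ cl) (Ops._+F_ cl) (Ops.1F cl) (Ops.0F cl) (Ops.barF cl)
             (Ops.ιB cl))
mainTheorem4 𝐁 =
  PointedBimonoid.isCommBimonoid brouwerianAlgebra 𝟘 , fClosure , record
    { isComplemented = record
      { isCommBimonoid = ∘ν-+F-isCommBimonoid
      ; complement     = barF-isComplement
      }
    ; isEmbedding    = ιB-isBimonoidEmbedding
    ; fractions      = fraction
    }
  where
  open BooleanPointedBrouwerianAlgebra 𝐁 using (brouwerianAlgebra; 𝟘)
  open Fractions 𝐁
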